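{- Let $m,j,k,n$ be positive integers with $1\le m\le j<k\le n$. The number of $1$-metered $(m,n)$-parking functions in which the last car (car $m$) parks in spot $j$ equals the number of $1$-metered $(m,n)$-parking functions in which car $m$ parks in spot $k$.
   Context: $[n]=\{1,\dots,n\}$. The $t$-metered parking scheme for $\alpha=(a_1,\dots,a_m)\in[n]^m$: there are $n$ spots $1,\dots,n$; cars $1,\dots,m$ arrive in order; car $i$ drives to spot $a_i$, parks there if unoccupied, and otherwise parks in the first unoccupied spot numbered greater than $a_i$; if there is none, the car fails to park. Immediately after car $j$ parks, car $j-t$ (if $j-t\ge1$) leaves. $\alpha$ is a $t$-metered $(m,n)$-parking function if all $m$ cars park. -}

module Defs where

open import Data.Nat using (ℕ; zero; suc; _+_; _∸_; _≤_; _<_; _≤ᵇ_)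
open import Data.Nat.Properties using (_≟_)
import Data.Bool as B
open import Data.Bool using (Bool; true; false; if_then_else_)
open import Data.Fin using (Fin; toℕ)
open import Data.List using (List; []; _∷_; length; filter; drop; _∷ʳ_; reverse; take; last)
open import Data.List.Membership.DecPropositional _≟_ using (_∈?_)
open import Data.Maybe using (Maybe; just; nothing)
open import Data.Vec using (Vec; toList)
import Data.Vec as V
open import Data.List using (allFin; concatMap; map)
open import Relation.Nullary.Decidable using (does)

-- Spots are numbered 1..n.  A preference sequence α ∈ [n]^m is a
-- Vec (Fin n) m, where the Fin value i encodes spot toℕ i + 1.

firstFree : (occ : List ℕ) (s fuel : ℕ) → Maybe ℕ
firstFree occ s zero = nothing
firstFree occ s (suc f) with does (s ∈? occ)
... | true  = firstFree occ (suc s) f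
... | false = just s

-- State: `parked` = list of spots in which cars 1..j parked, in arrival order
-- (the spot of car i is the i-th entry).  Occupied spots when car j+1 arrives
-- are those of cars j-t+1 .. j still present, i.e. the last t entries
-- (cars j-t+1..j after car j-t left when car j parked).
occupied : (t : ℕ) → List ℕ → List ℕ
occupied t parked = drop (length parked ∸ t) parked

meteredRun : (t n : ℕ) → List ℕ → List ℕ → Maybe (List ℕ)
meteredRun t n parked [] = just parked
meteredRun t n parked (a ∷ as) with firstFree (occupied t parked) a (suc n ∸ a)
... | nothing = nothing
... | just s  = meteredRun t n (parked ∷ʳ s) as

prefs : ∀ {m n} → Vec (Fin n) m → List ℕ
prefs α = map (λ i → suc (toℕ i)) (toList α)

outcome : (t : ℕ) {m n : ℕ} → Vec (Fin n) m → Maybe (List ℕ)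
outcome t {n = n} α = meteredRun t n [] (prefs α)

lastParksAt : (t j : ℕ) {m n : ℕ} → Vec (Fin n) m → Bool
lastParksAt t j α with outcome t α
... | nothing = false
... | just ss with last ss
...   | nothing = false
...   | just s  = does (s ≟ j)

allVecs : (m n : ℕ) → List (Vec (Fin n) m)
allVecs zero    n = V.[] ∷ []
allVecs (suc m) n = concatMap (λ i → map (i V.∷_) (allVecs m n)) (allFin n)

countLastAt : (t m n j : ℕ) → ℕ
countLastAt t m n j = length (filter (λ α → lastParksAt t j α B.≟ true) (allVecs m n))

-- In the 1-metered scheme an arriving car sees only the spot q of the previous
-- car, so with preference a it parks in a if a ≠ q and in q + 1 if a = q.  Hence,
-- for 2 ≤ j ≤ n, exactly [q ≠ j] + [q = j − 1] of the n preferences of the next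
-- car send it to spot j.  Summing over all (m,n) sequences α, with L(m,j) the
-- number of those whose last car parks in j and P(m) the number in which all
-- cars park,
--   L(m+1, j) + L(m, j) = P(m) + L(m, j − 1).
-- Since L(1, j) = 1 = P(0), induction on m gives L(m+1, j) = P(m) whenever
-- m + 1 ≤ j ≤ n, which does not depend on j.

module Submission where

open import Defs
open import Data.Nat using (ℕ; zero; suc; _+_; _*_; _∸_; _≤_; _<_; _≡ᵇ_; s≤s)
open import Data.Nat.Properties
  using ( _≟_; +-identityʳ; *-identityʳ; +-assoc; +-comm; +-cancelʳ-≡; +-∸-assoc; m+n∸n≡m
        ; ≤-trans; <⇒≤; n≤1+n; m≤n⇒m≤1+n; m≤n⇒m<n∨m≡n; >⇒≢; +-commutativeSemigroup )
open import Data.Nat.ListAction using (sum)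
open import Data.Nat.ListAction.Properties using (sum-++)
open import Data.Bool using (Bool; true; false; not; if_then_else_)
import Data.Bool as B
open import Data.Fin using (Fin; toℕ)
open import Data.Fin.Properties using (toℕ<n)
open import Data.List using (List; []; _∷_; _++_; _∷ʳ_; [_]; length; filter; last; map; concatMap; allFin; tabulate)
open import Data.List.Properties using (map-++; map-cong; map-∘; map-tabulate)
open import Data.Maybe using (Maybe; just; nothing; maybe′; is-just; _>>=_)
open import Data.Maybe.Properties using (≡-dec)
open import Data.Sum using (inj₁; inj₂)
open import Data.Vec using (Vec; toList)
import Data.Vec as V
open import Data.Vec.Properties using (toList-∷ʳ)
open import Data.List.Membership.DecPropositional _≟_ using (_∈_; _∈?_)
open import Data.List.Relation.Unary.Any using (here)
open import Relation.Nullary using (¬_)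
open import Relation.Nullary.Decidable using (yes; no; dec-true; dec-false)
open import Function using (_∘_; id)
open import Algebra.Properties.CommutativeSemigroup +-commutativeSemigroup using (interchange)
open import Relation.Binary.PropositionalEquality
  using (_≡_; _≢_; refl; sym; trans; cong; cong₂; module ≡-Reasoning)

𝕀 : Bool → ℕ
𝕀 true  = 1
𝕀 false = 0

𝕀-not : ∀ b → 𝕀 (not b) + 𝕀 b ≡ 1
𝕀-not true  = refl
𝕀-not false = refl

𝕀-if : ∀ c a b → 𝕀 (if c then a else b) ≡ 𝕀 b * 𝕀 (not c) + 𝕀 a * 𝕀 c
𝕀-if true  true  true  = refl
𝕀-if true  true  false = refl
𝕀-if true  false true  = refl
𝕀-if true  false false = refl
𝕀-if false true  true  = refl
𝕀-if false true  false = refl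
𝕀-if false false true  = refl
𝕀-if false false false = refl

infix 4 _≐_
_≐_ : Maybe ℕ → ℕ → Bool
just s  ≐ j = s ≡ᵇ j
nothing ≐ j = false

≐-false : ∀ {j} q → q ≢ just j → (q ≐ j) ≡ false
≐-false nothing  q≢ = refl
≐-false (just p) q≢ = dec-false (p ≟ _) (q≢ ∘ cong just)

sum-map-cong : ∀ {A : Set} {f g : A → ℕ} (xs : List A) → (∀ x → f x ≡ g x) → sum (map f xs) ≡ sum (map g xs)
sum-map-cong xs f≗g = cong sum (map-cong f≗g xs)

sum-map-0 : ∀ {A : Set} (xs : List A) → sum (map (λ _ → 0) xs) ≡ 0
sum-map-0 []       = refl
sum-map-0 (x ∷ xs) = sum-map-0 xs

sum-map-+ : ∀ {A : Set} (f g : A → ℕ) (xs : List A) →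
  sum (map (λ x → f x + g x) xs) ≡ sum (map f xs) + sum (map g xs)
sum-map-+ f g []       = refl
sum-map-+ f g (x ∷ xs) = begin
  (f x + g x) + sum (map (λ x → f x + g x) xs)  ≡⟨ cong (f x + g x +_) (sum-map-+ f g xs) ⟩
  (f x + g x) + (sum (map f xs) + sum (map g xs)) ≡⟨ interchange (f x) (g x) _ _ ⟩
  (f x + sum (map f xs)) + (g x + sum (map g xs)) ∎
  where open ≡-Reasoning

sum-map-concatMap : ∀ {A B : Set} (f : B → ℕ) (g : A → List B) (xs : List A) →
  sum (map f (concatMap g xs)) ≡ sum (map (λ x → sum (map f (g x))) xs)
sum-map-concatMap f g []       = refl
sum-map-concatMap f g (x ∷ xs) = begin
  sum (map f (g x ++ concatMap g xs))            ≡⟨ cong sum (map-++ f (g x) (concatMap g xs)) ⟩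
  sum (map f (g x) ++ map f (concatMap g xs))    ≡⟨ sum-++ (map f (g x)) _ ⟩
  sum (map f (g x)) + sum (map f (concatMap g xs)) ≡⟨ cong (sum (map f (g x)) +_) (sum-map-concatMap f g xs) ⟩
  sum (map f (g x)) + sum (map (λ x → sum (map f (g x))) xs) ∎
  where open ≡-Reasoning

sum-tabulate-0 : ∀ n → sum (tabulate {n = n} (λ _ → 0)) ≡ 0
sum-tabulate-0 zero    = refl
sum-tabulate-0 (suc n) = sum-tabulate-0 n

sum-tabulate-δ : ∀ {n} c (g : ℕ → ℕ) → c < n →
  sum (tabulate {n = n} (λ i → 𝕀 (toℕ i ≡ᵇ c) * g (toℕ i))) ≡ g c
sum-tabulate-δ {suc n} zero    g _         = trans (cong (g 0 + 0 +_) (sum-tabulate-0 n)) (trans (+-identityʳ _) (+-identityʳ _))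
sum-tabulate-δ {suc n} (suc c) g (s≤s c<n) = sum-tabulate-δ c (g ∘ suc) c<n

sum-allFin-δ : ∀ n c (g : ℕ → ℕ) → c < n →
  sum (map (λ i → 𝕀 (toℕ i ≡ᵇ c) * g (toℕ i)) (allFin n)) ≡ g c
sum-allFin-δ n c g c<n = trans (cong sum (map-tabulate {n = n} id (λ i → 𝕀 (toℕ i ≡ᵇ c) * g (toℕ i)))) (sum-tabulate-δ c g c<n)

sum-allVecs-∷ʳ : ∀ m n (f : Vec (Fin n) (suc m) → ℕ) →
  sum (map f (allVecs (suc m) n)) ≡ sum (map (λ α → sum (map (λ i → f (α V.∷ʳ i)) (allFin n))) (allVecs m n))
sum-allVecs-∷ʳ zero n f = begin
  sum (map f (concatMap (λ i → [ i V.∷ V.[] ]) (allFin n)))   ≡⟨ sum-map-concatMap f _ (allFin n) ⟩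
  sum (map (λ i → f (i V.∷ V.[]) + 0) (allFin n))             ≡⟨ sum-map-cong (allFin n) (λ i → +-identityʳ _) ⟩
  sum (map (λ i → f (i V.∷ V.[])) (allFin n))                 ≡⟨ +-identityʳ _ ⟨
  sum (map (λ i → f (i V.∷ V.[])) (allFin n)) + 0             ∎
  where open ≡-Reasoning
sum-allVecs-∷ʳ (suc m) n f = begin
  sum (map f (allVecs (suc (suc m)) n))
    ≡⟨ sum-map-concatMap f _ (allFin n) ⟩
  sum (map (λ i → sum (map f (map (i V.∷_) (allVecs (suc m) n)))) (allFin n))
    ≡⟨ sum-map-cong (allFin n) (λ i → trans (cong sum (sym (map-∘ (allVecs (suc m) n)))) (sum-allVecs-∷ʳ m n (f ∘ (i V.∷_)))) ⟩
  sum (map (λ i → sum (map (λ β → g (i V.∷ β)) (allVecs m n))) (allFin n))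
    ≡⟨ sum-map-cong (allFin n) (λ i → cong sum (map-∘ (allVecs m n))) ⟩
  sum (map (λ i → sum (map g (map (i V.∷_) (allVecs m n)))) (allFin n))
    ≡⟨ sum-map-concatMap g _ (allFin n) ⟨
  sum (map g (allVecs (suc m) n))
    ∎
  where
  open ≡-Reasoning
  g : Vec (Fin n) (suc m) → ℕ
  g α = sum (map (λ i → f (α V.∷ʳ i)) (allFin n))

meteredRun-++ : ∀ t n ps as bs →
  meteredRun t n ps (as ++ bs) ≡ (meteredRun t n ps as >>= λ ps′ → meteredRun t n ps′ bs)
meteredRun-++ t n ps []       bs = refl
meteredRun-++ t n ps (a ∷ as) bs with firstFree (occupied t ps) a (suc n ∸ a)
... | nothing = refl
... | just s  = meteredRun-++ t n (ps ∷ʳ s) as bs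

outcome-∷ʳ : ∀ t {m n} (α : Vec (Fin n) m) i →
  outcome t (α V.∷ʳ i) ≡ (outcome t α >>= λ ps → meteredRun t n ps [ suc (toℕ i) ])
outcome-∷ʳ t {n = n} α i = begin
  meteredRun t n [] (map pref (toList (α V.∷ʳ i)))      ≡⟨ cong (meteredRun t n [] ∘ map pref) (toList-∷ʳ i α) ⟩
  meteredRun t n [] (map pref (toList α ++ [ i ]))      ≡⟨ cong (meteredRun t n []) (map-++ pref (toList α) [ i ]) ⟩
  meteredRun t n [] (prefs α ++ [ pref i ])             ≡⟨ meteredRun-++ t n [] (prefs α) [ pref i ] ⟩
  (outcome t α >>= λ ps → meteredRun t n ps [ pref i ]) ∎
  where
  open ≡-Reasoning
  pref : Fin n → ℕ
  pref i = suc (toℕ i)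

last-∷ʳ : ∀ {A : Set} (xs : List A) x → last (xs ∷ʳ x) ≡ just x
last-∷ʳ []           x = refl
last-∷ʳ (_ ∷ [])     x = refl
last-∷ʳ (_ ∷ y ∷ xs) x = last-∷ʳ (y ∷ xs) x

occupied-1 : ∀ ps → occupied 1 ps ≡ maybe′ [_] [] (last ps)
occupied-1 []           = refl
occupied-1 (_ ∷ [])     = refl
occupied-1 (_ ∷ y ∷ ps) = occupied-1 (y ∷ ps)

-- In the 1-metered scheme the only occupied spot is the previous car's (occupied-1).
park : (n : ℕ) → Maybe ℕ → ℕ → Maybe ℕ
park n q a = firstFree (maybe′ [_] [] q) a (suc n ∸ a)

park-last : ∀ n ps a → firstFree (occupied 1 ps) a (suc n ∸ a) ≡ park n (last ps) a
park-last n ps a = cong (λ occ → firstFree occ a (suc n ∸ a)) (occupied-1 ps)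

meteredRun-1-last : ∀ n ps a → (meteredRun 1 n ps [ a ] >>= last) ≡ park n (last ps) a
meteredRun-1-last n ps a with firstFree (occupied 1 ps) a (suc n ∸ a) in eq
... | nothing = trans (sym eq) (park-last n ps a)
... | just s  = trans (last-∷ʳ ps s) (trans (sym eq) (park-last n ps a))

lastSpot : ∀ {m n} → Vec (Fin n) m → Maybe ℕ
lastSpot α = outcome 1 α >>= last

lastSpot-∷ʳ : ∀ {m n} (α : Vec (Fin n) m) i →
  lastSpot (α V.∷ʳ i) ≡ (outcome 1 α >>= λ ps → park n (last ps) (suc (toℕ i)))
lastSpot-∷ʳ {n = n} α i rewrite outcome-∷ʳ 1 α i with outcome 1 α
... | nothing = refl
... | just ps = meteredRun-1-last n ps (suc (toℕ i))

∉-maybe′ : ∀ {s} q → q ≢ just s → ¬ (s ∈ maybe′ [_] [] q)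
∉-maybe′ nothing  q≢ ()
∉-maybe′ (just p) q≢ (here refl) = q≢ refl

park-unblocked : ∀ {n} q x → x < n → q ≢ just (suc x) → park n q (suc x) ≡ just (suc x)
park-unblocked {n} q x x<n q≢ = trans (cong (firstFree occ (suc x)) (+-∸-assoc 1 x<n)) free
  where
  occ : List ℕ
  occ = maybe′ [_] [] q
  free : firstFree occ (suc x) (suc (n ∸ suc x)) ≡ just (suc x)
  free rewrite dec-false (suc x ∈? occ) (∉-maybe′ q q≢) = refl

park-blocked : ∀ {n} x → suc x < n → park n (just (suc x)) (suc x) ≡ just (suc (suc x))
park-blocked {n} x sx<n = trans (cong (firstFree [ suc x ] (suc x)) (+-∸-assoc 2 sx<n)) shift
  where
  shift : firstFree [ suc x ] (suc x) (2 + (n ∸ suc (suc x))) ≡ just (suc (suc x))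
  shift rewrite dec-true (suc x ∈? [ suc x ]) (here refl)
              | dec-false (suc (suc x) ∈? [ suc x ]) (∉-maybe′ (just (suc x)) λ ()) = refl

park-full : ∀ x → park (suc x) (just (suc x)) (suc x) ≡ nothing
park-full x = trans (cong (firstFree [ suc x ] (suc x)) (m+n∸n≡m 1 x)) full
  where
  full : firstFree [ suc x ] (suc x) 1 ≡ nothing
  full rewrite dec-true (suc x ∈? [ suc x ]) (here refl) = refl

park-≐ : ∀ {n} q x j → x < n → j ≤ n →
  (park n q (suc x) ≐ j) ≡ (if q ≐ suc x then suc (suc x) ≡ᵇ j else suc x ≡ᵇ j)
park-≐ q x j x<n j≤n with ≡-dec _≟_ q (just (suc x))
... | no q≢ rewrite ≐-false q q≢ = cong (_≐ j) (park-unblocked q x x<n q≢)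
... | yes refl rewrite dec-true (x ≟ x) refl with m≤n⇒m<n∨m≡n x<n
...   | inj₁ sx<n = cong (_≐ j) (park-blocked x sx<n)
...   | inj₂ refl = trans (cong (_≐ j) (park-full x)) (sym (dec-false (suc (suc x) ≟ j) (>⇒≢ (s≤s j≤n))))

arrivals : (n : ℕ) → Maybe ℕ → ℕ → ℕ
arrivals n q j = sum (map (λ i → 𝕀 (park n q (suc (toℕ i)) ≐ j)) (allFin n))

arrivals-nothing : ∀ {n} c → c < n → arrivals n nothing (suc c) ≡ 1
arrivals-nothing {n} c c<n = begin
  arrivals n nothing (suc c)
    ≡⟨ sum-map-cong (allFin n) (λ i → trans (cong 𝕀 (park-≐ nothing (toℕ i) (suc c) (toℕ<n i) c<n)) (sym (*-identityʳ _))) ⟩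
  sum (map (λ i → 𝕀 (toℕ i ≡ᵇ c) * 1) (allFin n))
    ≡⟨ sum-allFin-δ n c (λ _ → 1) c<n ⟩
  1 ∎
  where open ≡-Reasoning

arrivals-suc-suc : ∀ {n} c q → suc (suc c) ≤ n →
  arrivals n q (suc (suc c)) + 𝕀 (q ≐ suc (suc c)) ≡ 1 + 𝕀 (q ≐ suc c)
arrivals-suc-suc {n} c q j≤n = begin
  arrivals n q j + 𝕀 (q ≐ j)                         ≡⟨ cong (_+ 𝕀 (q ≐ j)) split ⟩
  (𝕀 (not (q ≐ j)) + 𝕀 (q ≐ suc c)) + 𝕀 (q ≐ j)     ≡⟨ +-assoc (𝕀 (not (q ≐ j))) _ _ ⟩
  𝕀 (not (q ≐ j)) + (𝕀 (q ≐ suc c) + 𝕀 (q ≐ j))     ≡⟨ cong (𝕀 (not (q ≐ j)) +_) (+-comm (𝕀 (q ≐ suc c)) _) ⟩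
  𝕀 (not (q ≐ j)) + (𝕀 (q ≐ j) + 𝕀 (q ≐ suc c))     ≡⟨ +-assoc (𝕀 (not (q ≐ j))) _ _ ⟨
  (𝕀 (not (q ≐ j)) + 𝕀 (q ≐ j)) + 𝕀 (q ≐ suc c)     ≡⟨ cong (_+ 𝕀 (q ≐ suc c)) (𝕀-not (q ≐ j)) ⟩
  1 + 𝕀 (q ≐ suc c)                                 ∎
  where
  open ≡-Reasoning
  j : ℕ
  j = suc (suc c)
  split : arrivals n q j ≡ 𝕀 (not (q ≐ j)) + 𝕀 (q ≐ suc c)
  split = begin
    arrivals n q j
      ≡⟨ sum-map-cong (allFin n) (λ i → trans (cong 𝕀 (park-≐ q (toℕ i) j (toℕ<n i) j≤n)) (𝕀-if (q ≐ suc (toℕ i)) _ _)) ⟩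
    sum (map (λ i → 𝕀 (toℕ i ≡ᵇ suc c) * 𝕀 (not (q ≐ suc (toℕ i))) + 𝕀 (toℕ i ≡ᵇ c) * 𝕀 (q ≐ suc (toℕ i))) (allFin n))
      ≡⟨ sum-map-+ _ _ (allFin n) ⟩
    sum (map (λ i → 𝕀 (toℕ i ≡ᵇ suc c) * 𝕀 (not (q ≐ suc (toℕ i)))) (allFin n))
      + sum (map (λ i → 𝕀 (toℕ i ≡ᵇ c) * 𝕀 (q ≐ suc (toℕ i))) (allFin n))
      ≡⟨ cong₂ _+_ (sum-allFin-δ n (suc c) (λ x → 𝕀 (not (q ≐ suc x))) j≤n)
                   (sum-allFin-δ n c (λ x → 𝕀 (q ≐ suc x)) (≤-trans (n≤1+n _) j≤n)) ⟩
    𝕀 (not (q ≐ j)) + 𝕀 (q ≐ suc c) ∎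

#lastAt : (m n j : ℕ) → ℕ
#lastAt m n j = sum (map (λ α → 𝕀 (lastSpot α ≐ j)) (allVecs m n))

#parking : (m n : ℕ) → ℕ
#parking m n = sum (map (λ α → 𝕀 (is-just (outcome 1 α))) (allVecs m n))

length-filter-true : ∀ {A : Set} (b : A → Bool) xs →
  length (filter (λ x → b x B.≟ true) xs) ≡ sum (map (𝕀 ∘ b) xs)
length-filter-true b []       = refl
length-filter-true b (x ∷ xs) with b x
... | true  = cong suc (length-filter-true b xs)
... | false = length-filter-true b xs

lastParksAt-1 : ∀ j {m n} (α : Vec (Fin n) m) → lastParksAt 1 j α ≡ (lastSpot α ≐ j)
lastParksAt-1 j α with outcome 1 α
... | nothing = refl
... | just ss with last ss
...   | nothing = refl
...   | just s  = refl

countLastAt≡#lastAt : ∀ m n j → countLastAt 1 m n j ≡ #lastAt m n j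
countLastAt≡#lastAt m n j =
  trans (length-filter-true (lastParksAt 1 j) (allVecs m n))
        (sum-map-cong (allVecs m n) (λ α → cong 𝕀 (lastParksAt-1 j α)))

sum-lastSpot-∷ʳ : ∀ {m n} c (α : Vec (Fin n) m) → suc (suc c) ≤ n →
  sum (map (λ i → 𝕀 (lastSpot (α V.∷ʳ i) ≐ suc (suc c))) (allFin n)) + 𝕀 (lastSpot α ≐ suc (suc c))
    ≡ 𝕀 (is-just (outcome 1 α)) + 𝕀 (lastSpot α ≐ suc c)
sum-lastSpot-∷ʳ {n = n} c α j≤n =
  trans (cong (_+ 𝕀 (lastSpot α ≐ j)) (sum-map-cong (allFin n) (λ i → cong (λ s → 𝕀 (s ≐ j)) (lastSpot-∷ʳ α i))))
        (by-outcome (outcome 1 α))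
  where
  j : ℕ
  j = suc (suc c)
  by-outcome : ∀ o →
    sum (map (λ i → 𝕀 ((o >>= λ ps → park n (last ps) (suc (toℕ i))) ≐ j)) (allFin n)) + 𝕀 ((o >>= last) ≐ j)
      ≡ 𝕀 (is-just o) + 𝕀 ((o >>= last) ≐ suc c)
  by-outcome nothing   = cong (_+ 0) (sum-map-0 (allFin n))
  by-outcome (just ps) = arrivals-suc-suc c (last ps) j≤n

#lastAt-recurrence : ∀ m {n} c → suc (suc c) ≤ n →
  #lastAt (suc m) n (suc (suc c)) + #lastAt m n (suc (suc c)) ≡ #parking m n + #lastAt m n (suc c)
#lastAt-recurrence m {n} c j≤n = begin
  #lastAt (suc m) n j + #lastAt m n j
    ≡⟨ cong (_+ #lastAt m n j) (sum-allVecs-∷ʳ m n _) ⟩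
  sum (map (λ α → sum (map (λ i → 𝕀 (lastSpot (α V.∷ʳ i) ≐ j)) (allFin n))) (allVecs m n)) + #lastAt m n j
    ≡⟨ sum-map-+ _ _ (allVecs m n) ⟨
  sum (map (λ α → sum (map (λ i → 𝕀 (lastSpot (α V.∷ʳ i) ≐ j)) (allFin n)) + 𝕀 (lastSpot α ≐ j)) (allVecs m n))
    ≡⟨ sum-map-cong (allVecs m n) (λ α → sum-lastSpot-∷ʳ c α j≤n) ⟩
  sum (map (λ α → 𝕀 (is-just (outcome 1 α)) + 𝕀 (lastSpot α ≐ suc c)) (allVecs m n))
    ≡⟨ sum-map-+ _ _ (allVecs m n) ⟩
  #parking m n + #lastAt m n (suc c) ∎
  where
  open ≡-Reasoning
  j : ℕ
  j = suc (suc c)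

#lastAt-1 : ∀ {n} c → c < n → #lastAt 1 n (suc c) ≡ 1
#lastAt-1 {n} c c<n = begin
  #lastAt 1 n (suc c)
    ≡⟨ sum-allVecs-∷ʳ 0 n _ ⟩
  sum (map (λ i → 𝕀 (lastSpot (V.[] V.∷ʳ i) ≐ suc c)) (allFin n)) + 0
    ≡⟨ +-identityʳ _ ⟩
  sum (map (λ i → 𝕀 (lastSpot (V.[] V.∷ʳ i) ≐ suc c)) (allFin n))
    ≡⟨ sum-map-cong (allFin n) (λ i → cong (λ s → 𝕀 (s ≐ suc c)) (lastSpot-∷ʳ V.[] i)) ⟩
  arrivals n nothing (suc c)
    ≡⟨ arrivals-nothing c c<n ⟩
  1 ∎
  where open ≡-Reasoning

#lastAt≡#parking : ∀ m {n j} → suc m ≤ j → j ≤ n → #lastAt (suc m) n j ≡ #parking m n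
#lastAt≡#parking zero    {j = suc c} _ j≤n = #lastAt-1 c j≤n
#lastAt≡#parking (suc m) {n} {suc (suc c)} (s≤s m<j) j≤n =
  +-cancelʳ-≡ (#parking m n) _ _ (begin
    #lastAt (suc (suc m)) n j + #parking m n       ≡⟨ cong (#lastAt (suc (suc m)) n j +_) (#lastAt≡#parking m (m≤n⇒m≤1+n m<j) j≤n) ⟨
    #lastAt (suc (suc m)) n j + #lastAt (suc m) n j ≡⟨ #lastAt-recurrence (suc m) c j≤n ⟩
    #parking (suc m) n + #lastAt (suc m) n (suc c)  ≡⟨ cong (#parking (suc m) n +_) (#lastAt≡#parking m m<j (≤-trans (n≤1+n _) j≤n)) ⟩
    #parking (suc m) n + #parking m n ∎)
  where
  open ≡-Reasoning
  j : ℕ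
  j = suc (suc c)

lemma3p9 : (m j k n : ℕ) → 1 ≤ m → m ≤ j → j < k → k ≤ n →
    countLastAt 1 m n j ≡ countLastAt 1 m n k
lemma3p9 (suc m) j k n _ m≤j j<k k≤n = begin
  countLastAt 1 (suc m) n j ≡⟨ countLastAt≡#lastAt (suc m) n j ⟩
  #lastAt (suc m) n j       ≡⟨ #lastAt≡#parking m m≤j (≤-trans (<⇒≤ j<k) k≤n) ⟩
  #parking m n              ≡⟨ #lastAt≡#parking m (≤-trans m≤j (<⇒≤ j<k)) k≤n ⟨
  #lastAt (suc m) n k       ≡⟨ countLastAt≡#lastAt (suc m) n k ⟨
  countLastAt 1 (suc m) n k ∎
  where open ≡-Reasoning
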